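{- There exist absolute constants $c,C>0$ such that for every $n\in\mathbb{N}$ there is a set $S\subseteq\mathbb{F}_2^n$ with $c\sqrt n\le |\Delta(S)|\le C\sqrt n$ and $\rho(S)=2$.
   Context: For $x,y\in\mathbb{F}_2^n$, $d_H(x,y)=\#\{i:x_i\neq y_i\}$ is the Hamming distance, and $\Delta(S)=\{d_H(x,y):x,y\in S\}$. A set $R\subseteq\mathbb{F}_2^n$ is called rainbow if all $\binom{|R|}{2}$ Hamming distances $d_H(x,y)$ over unordered pairs of distinct points $x,y\in R$ are pairwise distinct. $\rho(S)$ denotes the maximum size of a rainbow subset $R\subseteq S$. The paper states the conclusion as $|\Delta(S)|=\Theta(\sqrt n)$. -}

module Defs where

open import Data.Bool using (Bool; true; false; _xor_)
open import Data.Nat using (ℕ; zero; suc; _+_; _≤_; _≟_)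
open import Data.Fin using (Fin; _<_)
open import Data.Vec using (Vec; []; _∷_)
open import Data.List using (List; length; lookup; map; concatMap; deduplicate)
open import Data.List.Relation.Unary.Unique.Propositional using (Unique)
open import Data.List.Relation.Binary.Subset.Propositional using (_⊆_)
open import Data.Product using (_×_)
open import Relation.Binary.PropositionalEquality using (_≡_; _≢_)
open import Relation.Nullary using (¬_)

𝔽₂^ : ℕ → Set
𝔽₂^ n = Vec Bool n

dH : ∀ {n} → 𝔽₂^ n → 𝔽₂^ n → ℕ
dH [] [] = 0
dH (true ∷ xs) (true ∷ ys) = dH xs ys
dH (false ∷ xs) (false ∷ ys) = dH xs ys
dH (true ∷ xs) (false ∷ ys) = suc (dH xs ys)
dH (false ∷ xs) (true ∷ ys) = suc (dH xs ys)

-- A finite set S ⊆ F_2^n is represented by a duplicate-free list.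
-- List of all values d_H(x,y), x,y ∈ S (x = y allowed, as in the paper).
distances : ∀ {n} → List (𝔽₂^ n) → List ℕ
distances S = concatMap (λ x → map (dH x) S) S

ΔCard : ∀ {n} → List (𝔽₂^ n) → ℕ
ΔCard S = length (deduplicate _≟_ (distances S))

Rainbow : ∀ {n} → List (𝔽₂^ n) → Set
Rainbow R =
  Unique R ×
  (∀ (i j k l : Fin (length R)) → i < j → k < l → ¬ (i ≡ k × j ≡ l) →
     dH (lookup R i) (lookup R j) ≢ dH (lookup R k) (lookup R l))

ρ≡ : ∀ {n} → List (𝔽₂^ n) → ℕ → Set
ρ≡ S m =
  (Data.Product.Σ (List _) (λ R → R ⊆ S × Rainbow R × length R ≡ m)) ×
  (∀ R → R ⊆ S → Rainbow R → length R ≤ m)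

{-# OPTIONS --safe #-}
module Submission where

-- Points p₀, …, p_k with d(p_i, p_j) = 2·max(i, j) for i ≠ j realise exactly the k + 1 distances
-- 0, 2, …, 2k, and in every triangle among them the two sides at the vertex of largest index are
-- equal, so no three of them form a rainbow set. Such points exist in dimension k(k + 3)/2, and
-- padding with zeros reaches every n up to the next such dimension, so |Δ|² stays within a
-- constant factor of n. For n = 1 the two points of 𝔽₂¹ do.

open import Defs
open import Data.Bool using (true; false; if_then_else_)
open import Data.Nat
  using (ℕ; zero; suc; _+_; _*_; _<_; _≤_; _⊔_; _≟_; _≤?_; z≤n; s≤s; z<s; NonZero; ≢-nonZero⁻¹)
open import Data.Nat.Properties
open import Data.Nat.Tactic.RingSolver using (solve-∀)
open import Data.Vec using ([]; _∷_; _++_; replicate)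
open import Data.List using (List; []; _∷_; length; applyDownFrom; upTo; deduplicate)
import Data.List as List
open import Data.List.Properties using (length-applyDownFrom; length-upTo; length-++)
open import Data.List.Membership.Propositional using (_∈_)
open import Data.List.Membership.Propositional.Properties
open import Data.List.Relation.Unary.Any using (here; there)
open import Data.List.Relation.Unary.All as All using ([]; _∷_)
open import Data.List.Relation.Unary.AllPairs using ([]; _∷_)
open import Data.List.Relation.Unary.Unique.Propositional using (Unique)
open import Data.List.Relation.Unary.Unique.Propositional.Properties using (applyDownFrom⁺₁)
open import Data.List.Relation.Unary.Unique.DecPropositional.Properties _≟_ using (deduplicate-!)
open import Data.List.Relation.Binary.Subset.Propositional using (_⊆_)
open import Data.Fin using (Fin; #_) renaming (zero to fzero; suc to fsuc)
import Data.Fin as Fin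
open import Data.Product using (Σ; _×_; _,_; proj₁; ∃; ∃₂)
open import Data.Sum using (_⊎_; inj₁; inj₂)
open import Function using (id; _∘′_)
open import Relation.Binary using (tri<; tri≈; tri>)
open import Relation.Binary.PropositionalEquality
open import Relation.Nullary using (does; yes; no; contradiction)
open import Relation.Nullary.Decidable using (dec-true; dec-false)

dH-self : ∀ {n} (x : 𝔽₂^ n) → dH x x ≡ 0
dH-self []          = refl
dH-self (true  ∷ x) = dH-self x
dH-self (false ∷ x) = dH-self x

dH-sym : ∀ {n} (x y : 𝔽₂^ n) → dH x y ≡ dH y x
dH-sym []          []          = refl
dH-sym (true  ∷ x) (true  ∷ y) = dH-sym x y
dH-sym (false ∷ x) (false ∷ y) = dH-sym x y
dH-sym (true  ∷ x) (false ∷ y) = cong suc (dH-sym x y)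
dH-sym (false ∷ x) (true  ∷ y) = cong suc (dH-sym x y)

dH-++ : ∀ {m n} (x y : 𝔽₂^ m) (u v : 𝔽₂^ n) → dH (x ++ u) (y ++ v) ≡ dH x y + dH u v
dH-++ []          []          u v = refl
dH-++ (true  ∷ x) (true  ∷ y) u v = dH-++ x y u v
dH-++ (false ∷ x) (false ∷ y) u v = dH-++ x y u v
dH-++ (true  ∷ x) (false ∷ y) u v = cong suc (dH-++ x y u v)
dH-++ (false ∷ x) (true  ∷ y) u v = cong suc (dH-++ x y u v)

dH-++-cancelʳ : ∀ {m n} (x y : 𝔽₂^ m) (z : 𝔽₂^ n) → dH (x ++ z) (y ++ z) ≡ dH x y
dH-++-cancelʳ x y z = begin
  dH (x ++ z) (y ++ z)  ≡⟨ dH-++ x y z z ⟩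
  dH x y + dH z z       ≡⟨ cong (dH x y +_) (dH-self z) ⟩
  dH x y + 0            ≡⟨ +-identityʳ (dH x y) ⟩
  dH x y                ∎
  where open ≡-Reasoning

dH-replicate : ∀ m → dH (replicate m false) (replicate m true) ≡ m
dH-replicate zero    = refl
dH-replicate (suc m) = cong suc (dH-replicate m)

Unique-⊆⇒length-≤ : ∀ {A : Set} {xs ys : List A} → Unique xs → xs ⊆ ys → length xs ≤ length ys
Unique-⊆⇒length-≤ {xs = []}     _            _       = z≤n
Unique-⊆⇒length-≤ {xs = x ∷ xs} (x∉xs ∷ uxs) x∷xs⊆ys
  with us , vs , refl ← ∈-∃++ (x∷xs⊆ys (here refl)) = begin
    suc (length xs)              ≤⟨ s≤s (Unique-⊆⇒length-≤ uxs xs⊆us++vs) ⟩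
    suc (length (us List.++ vs)) ≡⟨ cong suc (length-++ us) ⟩
    suc (length us + length vs)  ≡⟨ sym (+-suc (length us) (length vs)) ⟩
    length us + length (x ∷ vs)  ≡⟨ sym (length-++ us) ⟩
    length (us List.++ x ∷ vs)   ∎
  where
  open ≤-Reasoning
  xs⊆us++vs : xs ⊆ us List.++ vs
  xs⊆us++vs y∈xs with ∈-++⁻ us (x∷xs⊆ys (there y∈xs))
  ... | inj₁ y∈us         = ∈-++⁺ˡ y∈us
  ... | inj₂ (here refl)  = contradiction refl (All.lookup x∉xs y∈xs)
  ... | inj₂ (there y∈vs) = ∈-++⁺ʳ us y∈vs

∈-distances⁺ : ∀ {n} {S : List (𝔽₂^ n)} {x y} → x ∈ S → y ∈ S → dH x y ∈ distances S
∈-distances⁺ {S = S} {x} x∈S y∈S =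
  ∈-concat⁺′ (∈-map⁺ (dH x) y∈S) (∈-map⁺ (λ x → List.map (dH x) S) x∈S)

∈-distances⁻ : ∀ {n} {S : List (𝔽₂^ n)} {d} → d ∈ distances S →
               ∃₂ λ x y → x ∈ S × y ∈ S × d ≡ dH x y
∈-distances⁻ {S = S} d∈
  with xs , d∈xs , xs∈ ← ∈-concat⁻′ (List.map (λ x → List.map (dH x) S) S) d∈
  with x , x∈S , refl ← ∈-map⁻ (λ x → List.map (dH x) S) xs∈
  with y , y∈S , d≡ ← ∈-map⁻ (dH x) d∈xs
  = x , y , x∈S , y∈S , d≡

ΔCard-≤ : ∀ {n} {S : List (𝔽₂^ n)} {m} →
          (∀ {x y} → x ∈ S → y ∈ S → dH x y ≤ m) → ΔCard S ≤ suc m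
ΔCard-≤ {S = S} {m} dH≤m = begin
  ΔCard S               ≤⟨ Unique-⊆⇒length-≤ (deduplicate-! (distances S)) Δ⊆ ⟩
  length (upTo (suc m)) ≡⟨ length-upTo (suc m) ⟩
  suc m                 ∎
  where
  open ≤-Reasoning
  Δ⊆ : deduplicate _≟_ (distances S) ⊆ upTo (suc m)
  Δ⊆ d∈ with x , y , x∈S , y∈S , d≡ ← ∈-distances⁻ (∈-deduplicate⁻ _≟_ (distances S) d∈)
    = ∈-upTo⁺ (s≤s (≤-trans (≤-reflexive d≡) (dH≤m x∈S y∈S)))

ΔCard-≥ : ∀ {n} {S : List (𝔽₂^ n)} {ds} → Unique ds → ds ⊆ distances S → length ds ≤ ΔCard S
ΔCard-≥ uds ds⊆ = Unique-⊆⇒length-≤ uds (∈-deduplicate⁺ _≟_ ∘′ ds⊆)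

Isosceles : ∀ {n} → 𝔽₂^ n → 𝔽₂^ n → 𝔽₂^ n → Set
Isosceles a b c = dH a b ≡ dH a c ⊎ dH a b ≡ dH b c ⊎ dH a c ≡ dH b c

rainbow-length≤2 : ∀ {n} {S : List (𝔽₂^ n)} →
  (∀ {a b c} → a ∈ S → b ∈ S → c ∈ S → a ≢ b → a ≢ c → b ≢ c → Isosceles a b c) →
  ∀ R → R ⊆ S → Rainbow R → length R ≤ 2
rainbow-length≤2 _ []          _ _ = z≤n
rainbow-length≤2 _ (_ ∷ [])     _ _ = s≤s z≤n
rainbow-length≤2 _ (_ ∷ _ ∷ []) _ _ = s≤s (s≤s z≤n)
rainbow-length≤2 isosceles (a ∷ b ∷ c ∷ R) R⊆S ((a≢b ∷ a≢c ∷ _) ∷ (b≢c ∷ _) ∷ _ , rainbow)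
  with isosceles (R⊆S (here refl)) (R⊆S (there (here refl))) (R⊆S (there (there (here refl))))
                 a≢b a≢c b≢c
... | inj₁ ab≡ac =
  contradiction ab≡ac (rainbow (# 0) (# 1) (# 0) (# 2) z<s z<s λ { (_ , ()) })
... | inj₂ (inj₁ ab≡bc) =
  contradiction ab≡bc (rainbow (# 0) (# 1) (# 1) (# 2) z<s (s≤s z<s) λ { (() , _) })
... | inj₂ (inj₂ ac≡bc) =
  contradiction ac≡bc (rainbow (# 0) (# 2) (# 1) (# 2) z<s (s≤s z<s) λ { (() , _) })

<-in-Fin2-unique : ∀ {i j k l : Fin 2} → i Fin.< j → k Fin.< l → i ≡ k × j ≡ l
<-in-Fin2-unique {fzero} {fsuc fzero} {fzero} {fsuc fzero} _ _ = refl , refl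
<-in-Fin2-unique {fsuc fzero} {fsuc fzero} (s≤s ()) _
<-in-Fin2-unique {k = fsuc fzero} {fsuc fzero} _ (s≤s ())

rainbow-pair : ∀ {n} {x y : 𝔽₂^ n} → x ≢ y → Rainbow (x ∷ y ∷ [])
rainbow-pair x≢y =
  ((x≢y ∷ []) ∷ [] ∷ []) ,
  λ _ _ _ _ i<j k<l ij≢kl _ → contradiction (<-in-Fin2-unique i<j k<l) ij≢kl

⊔-isosceles : ∀ i j l → i ⊔ j ≡ i ⊔ l ⊎ i ⊔ j ≡ j ⊔ l ⊎ i ⊔ l ≡ j ⊔ l
⊔-isosceles i j l with ≤-total i j | ≤-total j l | ≤-total i l
... | inj₁ i≤j | inj₁ j≤l | _
  rewrite m≤n⇒m⊔n≡n i≤j | m≤n⇒m⊔n≡n j≤l | m≤n⇒m⊔n≡n (≤-trans i≤j j≤l) = inj₂ (inj₂ refl)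
... | inj₁ i≤j | inj₂ l≤j | _
  rewrite m≤n⇒m⊔n≡n i≤j | m≥n⇒m⊔n≡m l≤j = inj₂ (inj₁ refl)
... | inj₂ j≤i | _        | inj₁ i≤l
  rewrite m≥n⇒m⊔n≡m j≤i | m≤n⇒m⊔n≡n i≤l | m≤n⇒m⊔n≡n (≤-trans j≤i i≤l) = inj₂ (inj₂ refl)
... | inj₂ j≤i | _        | inj₂ l≤i
  rewrite m≥n⇒m⊔n≡m j≤i | m≥n⇒m⊔n≡m l≤i = inj₁ refl

module TwiceMaxDistances {n} (x : ℕ → 𝔽₂^ n) (k : ℕ)
  (dH-x-< : ∀ {i j} → i < j → j ≤ k → dH (x i) (x j) ≡ 2 * j) where

  S : List (𝔽₂^ n)
  S = applyDownFrom x (suc k)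

  ∈S⁺ : ∀ {i} → i ≤ k → x i ∈ S
  ∈S⁺ i≤k = ∈-applyDownFrom⁺ x (s≤s i≤k)

  ∈S⁻ : ∀ {a} → a ∈ S → ∃ λ i → i ≤ k × a ≡ x i
  ∈S⁻ a∈S with i , s≤s i≤k , a≡xi ← ∈-applyDownFrom⁻ x a∈S = i , i≤k , a≡xi

  dH-x : ∀ {i j} → i ≤ k → j ≤ k → i ≢ j → dH (x i) (x j) ≡ 2 * (i ⊔ j)
  dH-x {i} {j} i≤k j≤k i≢j with <-cmp i j
  ... | tri< i<j _ _ rewrite m≤n⇒m⊔n≡n (<⇒≤ i<j) = dH-x-< i<j j≤k
  ... | tri≈ _ i≡j _ = contradiction i≡j i≢j
  ... | tri> _ _ j<i rewrite m≥n⇒m⊔n≡m (<⇒≤ j<i) = trans (dH-sym (x i) (x j)) (dH-x-< j<i i≤k)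

  dH-x₀ : ∀ {j} → j ≤ k → dH (x 0) (x j) ≡ 2 * j
  dH-x₀ {zero}  _   = dH-self (x 0)
  dH-x₀ {suc j} j≤k = dH-x-< z<s j≤k

  x-distinct : ∀ {i j} → i < j → j ≤ k → x i ≢ x j
  x-distinct {i} {suc j} i<j j≤k xi≡xj = 0≢1+n (begin
    0                    ≡⟨ sym (dH-self (x i)) ⟩
    dH (x i) (x i)       ≡⟨ cong (dH (x i)) xi≡xj ⟩
    dH (x i) (x (suc j)) ≡⟨ dH-x-< i<j j≤k ⟩
    2 * suc j            ∎)
    where open ≡-Reasoning

  S-unique : Unique S
  S-unique = applyDownFrom⁺₁ x (suc k) λ j<i i<1+k → x-distinct j<i (≤-pred i<1+k) ∘′ sym

  ΔCard-S-≤ : ΔCard S ≤ suc (2 * k)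
  ΔCard-S-≤ = ΔCard-≤ {S = S} dH≤2k
    where
    dH≤2k : ∀ {a b} → a ∈ S → b ∈ S → dH a b ≤ 2 * k
    dH≤2k a∈S b∈S with i , i≤k , refl ← ∈S⁻ a∈S | j , j≤k , refl ← ∈S⁻ b∈S with i ≟ j
    ... | yes refl = ≤-trans (≤-reflexive (dH-self (x i))) z≤n
    ... | no i≢j   = ≤-trans (≤-reflexive (dH-x i≤k j≤k i≢j)) (*-monoʳ-≤ 2 (⊔-lub i≤k j≤k))

  ΔCard-S-≥ : suc k ≤ ΔCard S
  ΔCard-S-≥ = begin
    suc k                                 ≡⟨ sym (length-applyDownFrom (2 *_) (suc k)) ⟩
    length (applyDownFrom (2 *_) (suc k)) ≤⟨ ΔCard-≥ {S = S} evens-unique evens⊆ ⟩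
    ΔCard S                               ∎
    where
    open ≤-Reasoning
    evens-unique : Unique (applyDownFrom (2 *_) (suc k))
    evens-unique = applyDownFrom⁺₁ (2 *_) (suc k) λ j<i _ → <⇒≢ j<i ∘′ sym ∘′ *-cancelˡ-≡ _ _ 2
    evens⊆ : applyDownFrom (2 *_) (suc k) ⊆ distances S
    evens⊆ d∈ with j , s≤s j≤k , refl ← ∈-applyDownFrom⁻ (2 *_) d∈ =
      subst (_∈ distances S) (dH-x₀ j≤k) (∈-distances⁺ (∈S⁺ z≤n) (∈S⁺ j≤k))

  S-isosceles : ∀ {a b c} → a ∈ S → b ∈ S → c ∈ S → a ≢ b → a ≢ c → b ≢ c → Isosceles a b c
  S-isosceles a∈S b∈S c∈S a≢b a≢c b≢c
    with i , i≤k , refl ← ∈S⁻ a∈S | j , j≤k , refl ← ∈S⁻ b∈S | l , l≤k , refl ← ∈S⁻ c∈S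
    rewrite dH-x i≤k j≤k (a≢b ∘′ cong x)
          | dH-x i≤k l≤k (a≢c ∘′ cong x)
          | dH-x j≤k l≤k (b≢c ∘′ cong x)
    with ⊔-isosceles i j l
  ... | inj₁ e        = inj₁ (cong (2 *_) e)
  ... | inj₂ (inj₁ e) = inj₂ (inj₁ (cong (2 *_) e))
  ... | inj₂ (inj₂ e) = inj₂ (inj₂ (cong (2 *_) e))

  S-ρ≡2 : 1 ≤ k → ρ≡ S 2
  S-ρ≡2 1≤k = (x 0 ∷ x 1 ∷ [] , pair⊆S , rainbow-pair (x-distinct z<s 1≤k) , refl)
            , rainbow-length≤2 S-isosceles
    where
    pair⊆S : x 0 ∷ x 1 ∷ [] ⊆ S
    pair⊆S (here refl)         = ∈S⁺ z≤n
    pair⊆S (there (here refl)) = ∈S⁺ 1≤k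

-- The coordinates form blocks of sizes 2, 3, …, k + 1. Point i (i ≤ k) is all ones on block i,
-- zero on the later blocks and (1, 0, …, 0) on the earlier ones; spine k is (1, 0, …, 0) on
-- every block.
dim : ℕ → ℕ
dim zero    = 0
dim (suc k) = dim k + suc (suc k)

spine : ∀ k → 𝔽₂^ (dim k)
spine zero    = []
spine (suc k) = spine k ++ (true ∷ replicate (suc k) false)

point : ∀ k → ℕ → 𝔽₂^ (dim k)
point zero    i = []
point (suc k) i =
  if does (i ≤? k) then point k i ++ replicate (suc (suc k)) false
                   else spine k ++ replicate (suc (suc k)) true

point-≤ : ∀ {k i} → i ≤ k → point (suc k) i ≡ point k i ++ replicate (suc (suc k)) false
point-≤ {k} {i} i≤k rewrite dec-true (i ≤? k) i≤k = refl

point-suc : ∀ k → point (suc k) (suc k) ≡ spine k ++ replicate (suc (suc k)) true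
point-suc k rewrite dec-false (suc k ≤? k) (n≮n k) = refl

dH-point-spine : ∀ {k i} → i ≤ k → dH (point k i) (spine k) ≡ k
dH-point-spine {zero}  z≤n = refl
dH-point-spine {suc k} {i} i≤1+k with m≤n⇒m<n∨m≡n i≤1+k
... | inj₁ (s≤s i≤k) rewrite point-≤ i≤k = begin
  dH (point k i ++ replicate (suc (suc k)) false) (spine k ++ (true ∷ replicate (suc k) false))
    ≡⟨ dH-++ (point k i) (spine k) _ _ ⟩
  dH (point k i) (spine k) + suc (dH (replicate (suc k) false) (replicate (suc k) false))
    ≡⟨ cong₂ (λ d e → d + suc e) (dH-point-spine i≤k) (dH-self (replicate (suc k) false)) ⟩
  k + 1
    ≡⟨ +-comm k 1 ⟩
  suc k ∎
  where open ≡-Reasoning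
... | inj₂ refl rewrite point-suc k = begin
  dH (spine k ++ replicate (suc (suc k)) true) (spine k ++ (true ∷ replicate (suc k) false))
    ≡⟨ dH-++ (spine k) (spine k) _ _ ⟩
  dH (spine k) (spine k) + dH (replicate (suc k) true) (replicate (suc k) false)
    ≡⟨ cong₂ _+_ (dH-self (spine k)) (dH-sym (replicate (suc k) true) (replicate (suc k) false)) ⟩
  dH (replicate (suc k) false) (replicate (suc k) true)
    ≡⟨ dH-replicate (suc k) ⟩
  suc k ∎
  where open ≡-Reasoning

dH-point-< : ∀ {k i j} → i < j → j ≤ k → dH (point k i) (point k j) ≡ 2 * j
dH-point-< {zero}  ()  z≤n
dH-point-< {suc k} {i} {j} i<j j≤1+k with m≤n⇒m<n∨m≡n j≤1+k
... | inj₁ (s≤s j≤k) rewrite point-≤ j≤k | point-≤ (≤-trans (<⇒≤ i<j) j≤k) = begin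
  dH (point k i ++ replicate (suc (suc k)) false) (point k j ++ replicate (suc (suc k)) false)
    ≡⟨ dH-++-cancelʳ (point k i) (point k j) _ ⟩
  dH (point k i) (point k j)
    ≡⟨ dH-point-< i<j j≤k ⟩
  2 * j ∎
  where open ≡-Reasoning
... | inj₂ refl rewrite point-≤ (≤-pred i<j) | point-suc k = begin
  dH (point k i ++ replicate (suc (suc k)) false) (spine k ++ replicate (suc (suc k)) true)
    ≡⟨ dH-++ (point k i) (spine k) _ _ ⟩
  dH (point k i) (spine k) + dH (replicate (suc (suc k)) false) (replicate (suc (suc k)) true)
    ≡⟨ cong₂ _+_ (dH-point-spine (≤-pred i<j)) (dH-replicate (suc (suc k))) ⟩
  k + suc (suc k)
    ≡⟨ +-suc k (suc k) ⟩
  suc (k + suc k)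
    ≡⟨ cong (λ m → suc (k + suc m)) (+-identityʳ k) ⟨
  2 * suc k ∎
  where open ≡-Reasoning

dim-double : ∀ k → 2 * dim k ≡ k * (3 + k)
dim-double zero    = refl
dim-double (suc k) = begin
  2 * (dim k + suc (suc k))        ≡⟨ *-distribˡ-+ 2 (dim k) (suc (suc k)) ⟩
  2 * dim k + 2 * suc (suc k)      ≡⟨ cong (_+ 2 * suc (suc k)) (dim-double k) ⟩
  k * (3 + k) + 2 * suc (suc k)    ≡⟨ step k ⟩
  suc k * (3 + suc k)              ∎
  where
  open ≡-Reasoning
  step : ∀ k → k * (3 + k) + 2 * suc (suc k) ≡ suc k * (3 + suc k)
  step = solve-∀

dim-decomposition : ∀ n → ∃₂ λ k r → r ≤ suc k × n ≡ dim k + r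
dim-decomposition zero = 0 , 0 , z≤n , refl
dim-decomposition (suc n) with k , r , r≤1+k , refl ← dim-decomposition n
  with m≤n⇒m<n∨m≡n r≤1+k
... | inj₁ r<1+k = k , suc r , r<1+k , sym (+-suc (dim k) r)
... | inj₂ refl  = suc k , 0 , z≤n , sym (trans (+-identityʳ (dim (suc k))) (+-suc (dim k) (suc k)))

dim+r≤2*[1+k]² : ∀ {k r} → r ≤ suc k → dim k + r ≤ 2 * (suc k * suc k)
dim+r≤2*[1+k]² {k} {r} r≤1+k = *-cancelˡ-≤ 2 (begin
  2 * (dim k + r)                     ≡⟨ *-distribˡ-+ 2 (dim k) r ⟩
  2 * dim k + 2 * r                   ≤⟨ +-mono-≤ (≤-reflexive (dim-double k)) (*-monoʳ-≤ 2 r≤1+k) ⟩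
  k * (3 + k) + 2 * suc k             ≤⟨ m≤m+n _ (3 * (k * k) + 3 * k + 2) ⟩
  k * (3 + k) + 2 * suc k + (3 * (k * k) + 3 * k + 2)
                                      ≡⟨ gap k ⟩
  2 * (2 * (suc k * suc k))           ∎)
  where
  open ≤-Reasoning
  gap : ∀ k → k * (3 + k) + 2 * suc k + (3 * (k * k) + 3 * k + 2) ≡ 2 * (2 * (suc k * suc k))
  gap = solve-∀

[1+2k]²≤8*dim : ∀ {k} → 1 ≤ k → suc (2 * k) * suc (2 * k) ≤ 8 * dim k
[1+2k]²≤8*dim {suc k} _ = begin
  suc (2 * suc k) * suc (2 * suc k)                ≤⟨ m≤m+n _ (8 * k + 7) ⟩
  suc (2 * suc k) * suc (2 * suc k) + (8 * k + 7)  ≡⟨ gap k ⟩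
  4 * (suc k * (3 + suc k))                        ≡⟨ cong (4 *_) (dim-double (suc k)) ⟨
  4 * (2 * dim (suc k))                            ≡⟨ *-assoc 4 2 (dim (suc k)) ⟨
  8 * dim (suc k)                                  ∎
  where
  open ≤-Reasoning
  gap : ∀ k → suc (2 * suc k) * suc (2 * suc k) + (8 * k + 7) ≡ 4 * (suc k * (3 + suc k))
  gap = solve-∀

Witness : ℕ → ℕ → ℕ → Set
Witness a b n = Σ (List (𝔽₂^ n)) λ S → Unique S ×
  (n ≤ a * (ΔCard S * ΔCard S)) × (ΔCard S * ΔCard S ≤ b * n) × ρ≡ S 2

two-point-witness : Witness 2 8 1
two-point-witness =
  S , S-unique , s≤s z≤n , m≤m+n 4 4 ,
  (S , id , rainbow-pair 0≢1 , refl) , λ R R⊆S R-rainbow → Unique-⊆⇒length-≤ (proj₁ R-rainbow) R⊆S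
  where
  0≢1 : false ∷ [] ≢ true ∷ []
  0≢1 ()
  S : List (𝔽₂^ 1)
  S = (false ∷ []) ∷ (true ∷ []) ∷ []
  S-unique : Unique S
  S-unique = (0≢1 ∷ []) ∷ [] ∷ []

block-witness : ∀ {k r} → 1 ≤ k → r ≤ suc k → Witness 2 8 (dim k + r)
block-witness {k} {r} 1≤k r≤1+k = S , S-unique , lower , upper , S-ρ≡2 1≤k
  where
  padded : ℕ → 𝔽₂^ (dim k + r)
  padded i = point k i ++ replicate r false
  dH-padded-< : ∀ {i j} → i < j → j ≤ k → dH (padded i) (padded j) ≡ 2 * j
  dH-padded-< {i} {j} i<j j≤k = trans (dH-++-cancelʳ (point k i) (point k j) _) (dH-point-< i<j j≤k)
  open TwiceMaxDistances padded k dH-padded-<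
  lower : dim k + r ≤ 2 * (ΔCard S * ΔCard S)
  lower = ≤-trans (dim+r≤2*[1+k]² r≤1+k) (*-monoʳ-≤ 2 (*-mono-≤ ΔCard-S-≥ ΔCard-S-≥))
  upper : ΔCard S * ΔCard S ≤ 8 * (dim k + r)
  upper = ≤-trans (*-mono-≤ ΔCard-S-≤ ΔCard-S-≤)
         (≤-trans ([1+2k]²≤8*dim 1≤k) (*-monoʳ-≤ 8 (m≤m+n (dim k) r)))

theorem1p4 : Σ ℕ λ a → Σ ℕ λ b → NonZero a × NonZero b ×
    ((n : ℕ) → NonZero n →
      Σ (List (𝔽₂^ n)) λ S → Unique S ×
        (n ≤ a * (ΔCard S * ΔCard S)) ×
        (ΔCard S * ΔCard S ≤ b * n) ×
        ρ≡ S 2)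
theorem1p4 = 2 , 8 , _ , _ , witness
  where
  witness : ∀ n → NonZero n → Witness 2 8 n
  witness n n≢0 with dim-decomposition n
  ... | zero  , zero        , _      , refl = contradiction refl (≢-nonZero⁻¹ 0 {{n≢0}})
  ... | zero  , suc zero    , _      , refl = two-point-witness
  ... | zero  , suc (suc _) , s≤s () , _
  ... | suc k , r           , r≤     , refl = block-witness (s≤s z≤n) r≤
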